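{- Let $\beta$ be a composition and $\lambda=(\lambda_1\ge\dots\ge\lambda_k>0)$ a partition. Then the super filling $S(\lambda,\beta)$ is a Littlewood–Richardson composition tableau, i.e. it satisfies conditions (LR1)–(LR4) below (with respect to $\beta$, padded by zero rows as in the construction).
   Context: Diagrams: a sequence $\alpha=(\alpha_1,\dots,\alpha_m)$ of row lengths has $\alpha_i$ cells in row $i$ (rows numbered from the top), cell $(i,j)$ in row $i$, column $j$. For a partition $\lambda$, $\lambda^*=(\lambda_k,\dots,\lambda_1)$ is its reverse. Composition tableau conditions for a filling $T$ of a diagram of shape $\alpha$: (CT1) entries weakly decrease along rows from left to right; (CT3) triple rule: for cells $(i,k),(j,k)$ in the same column with $i<j$: if $\alpha_i\ge\alpha_j$ then $T(j,k)<T(i,k)$ or $T(i,k-1)<T(j,k)$ (with $T(i,0)$ read as $0$); if $\alpha_i<\alpha_j$ then $T(j,k)<T(i,k)$ or $T(i,k)<T(j,k+1)$. Littlewood–Richardson composition tableaux: let $\lambda$ have $k$ parts, let $\beta=(\beta_1,\dots,\beta_r)$ have nonnegative parts, and let $\alpha$ be a shape obtained by adding $|\lambda|$ cells to the diagram of $\beta$ (appended to the right ends of rows of $\beta$, possibly also in new rows inserted between rows of $\beta$), the cells of $\beta$ occupying the left ends of their rows. A filling of $\alpha$ is an LR composition tableau if: (LR1) the cells of the $i$-th row from the bottom of $\beta$ are filled with $k+i$; (LR2) the appended cells have content $\lambda^*$, i.e. exactly $\lambda_{k-j+1}$ appended cells contain $j$, for $1\le j\le k$; (LR3) the filling satisfies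 (CT1) and (CT3); (LR4) reading the entries of the appended cells column by column from right to left, each column from top to bottom, gives a reverse lattice word: every prefix contains at least as many $i$'s as $(i-1)$'s for each $1<i\le k$. Super filling $S(\lambda,\beta)$: if $\ell(\lambda)>\ell(\beta)$, append $\ell(\lambda)-\ell(\beta)$ zeros to the end of $\beta$ (rows of length $0$ at the bottom). Fill the cells of the $i$-th row from the bottom of $\beta$ with $k+i$. Append $\lambda_i$ cells to the $i$-th longest row of $\beta$, where of two rows of $\beta$ of equal length the lower one is considered longer. Fill the new cells in the $j$-th longest row with the entry $k-j+1$, except that when two rows have the same length, the lower row is filled with the lesser entries. The resulting filling (of content $\lambda^*$ on the appended cells) is $S(\lambda,\beta)$. -}

module Defs where

open import Data.Nat using (ℕ; zero; suc; _+_; _∸_; _≤_; _<_; _≥_; _⊔_; _<ᵇ_; _≡ᵇ_)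
open import Data.Bool using (Bool; true; false; if_then_else_; _∧_; _∨_)
open import Data.List using (List; []; _∷_; length; map; upTo; downFrom; replicate; _++_; concat; foldr; take; filterᵇ)
open import Data.Nat.ListAction using (sum)
open import Data.Sum using (_⊎_)
open import Relation.Binary.PropositionalEquality using (_≡_)

get : List ℕ → ℕ → ℕ
get []       _       = 0
get (x ∷ xs) zero    = x
get (x ∷ xs) (suc i) = get xs i

-- 1-indexed access (cell column / partition part), default 0;
-- in particular  at r 0 = 0  (the convention T(i,0) = 0)
at : List ℕ → ℕ → ℕ
at xs zero    = 0
at xs (suc c) = get xs c

rowOf : List (List ℕ) → ℕ → List ℕ
rowOf []       _       = []
rowOf (r ∷ rs) zero    = r
rowOf (r ∷ rs) (suc i) = rowOf rs i

countᵇ : {A : Set} → (A → Bool) → List A → ℕ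
countᵇ p []       = 0
countᵇ p (x ∷ xs) = if p x then suc (countᵇ p xs) else countᵇ p xs

rangeOC : ℕ → ℕ → List ℕ
rangeOC a b = map (λ t → suc (a + t)) (upTo (b ∸ a))

data Decreasing : List ℕ → Set where
  dec-[] : Decreasing []
  dec-[x] : ∀ {x} → Decreasing (x ∷ [])
  dec-∷  : ∀ {x y xs} → x ≥ y → Decreasing (y ∷ xs) → Decreasing (x ∷ y ∷ xs)

data AllPos : List ℕ → Set where
  pos-[] : AllPos []
  pos-∷  : ∀ {x xs} → 0 < x → AllPos xs → AllPos (x ∷ xs)

IsPartition : List ℕ → Set
IsPartition la = Decreasing la

-- (IsPartition is used together with AllPos in the statement)

-- The super filling S(λ, β).  Rows are 0-indexed from the top.

pad : ℕ → List ℕ → List ℕ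
pad k β = β ++ replicate (k ∸ length β) 0

module SuperFilling (la : List ℕ) (β : List ℕ) where
  k : ℕ
  k = length la

  β′ : List ℕ
  β′ = pad k β

  r : ℕ
  r = length β′

  rows : List ℕ
  rows = upTo r

  -- row a of β′ is (strictly) longer than row b: longer length, or
  -- equal length and a is lower (a > b)
  βlonger : ℕ → ℕ → Bool
  βlonger a b = (get β′ b <ᵇ get β′ a) ∨ ((get β′ a ≡ᵇ get β′ b) ∧ (b <ᵇ a))

  -- row i is the (rankβ i)-th longest row of β′ (1-based)
  rankβ : ℕ → ℕ
  rankβ i = suc (countᵇ (λ a → βlonger a i) rows)

  -- λ_{rankβ i} cells are appended to row i (0 if rankβ i > k)
  appended : ℕ → ℕ
  appended i = at la (rankβ i)

  αlen : ℕ → ℕ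
  αlen i = get β′ i + appended i

  -- order used for the entries: the "longest" order (rankβ), except
  -- that among rows of the same (new) length the upper row comes first,
  -- so that the lower row receives the lesser entries
  before : ℕ → ℕ → Bool
  before a b = if αlen a ≡ᵇ αlen b then a <ᵇ b else rankβ a <ᵇ rankβ b

  entryRank : ℕ → ℕ
  entryRank i = suc (countᵇ (λ a → before a i) rows)

  superRow : ℕ → List ℕ
  superRow i = replicate (get β′ i) (k + (r ∸ i))
               ++ replicate (appended i) (suc k ∸ entryRank i)

  filling : List (List ℕ)
  filling = map superRow rows

superFilling : List ℕ → List ℕ → List (List ℕ)
superFilling la β = SuperFilling.filling la β

-- Littlewood–Richardson composition tableaux (shape α has the same rows
-- as β; the rows of the filling T are the rows of α, 0-indexed from top,
-- columns 1-indexed)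

occ : ℕ → List ℕ → ℕ
occ j = countᵇ (λ x → x ≡ᵇ j)

ReverseLattice : ℕ → List ℕ → Set
ReverseLattice k w =
  ∀ n i → 2 ≤ i → i ≤ k → occ (i ∸ 1) (take n w) ≤ occ i (take n w)

module LR (la : List ℕ) (β : List ℕ) (T : List (List ℕ)) where
  k : ℕ
  k = length la

  r : ℕ
  r = length β

  len : ℕ → ℕ
  len i = length (rowOf T i)

  ent : ℕ → ℕ → ℕ
  ent i c = at (rowOf T i) c

  appendedEntries : List ℕ
  appendedEntries =
    concat (map (λ i → map (ent i) (rangeOC (get β i) (len i))) (upTo r))

  numAppended : ℕ
  numAppended = sum (map (λ i → len i ∸ get β i) (upTo r))

  maxCol : ℕ
  maxCol = foldr _⊔_ 0 (map length T)

  readingWord : List ℕ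
  readingWord =
    concat (map (λ c → map (λ i → ent i c)
                           (filterᵇ (λ i → (get β i <ᵇ c) ∧ (c <ᵇ suc (len i))) (upTo r)))
                (map suc (downFrom maxCol)))

  record IsLRTableau : Set where
    field
      sameRows : length T ≡ r
      βfits    : ∀ i → i < r → get β i ≤ len i
      lr1 : ∀ i c → i < r → 1 ≤ c → c ≤ get β i → ent i c ≡ k + (r ∸ i)
      lr2-size    : numAppended ≡ sum la
      lr2-content : ∀ j → 1 ≤ j → j ≤ k → occ j appendedEntries ≡ at la (k ∸ j + 1)
      -- (LR3) = (CT1) and (CT3)
      ct1 : ∀ i c → i < r → 1 ≤ c → c < len i → ent i (suc c) ≤ ent i c
      ct3-≥ : ∀ i j c → i < j → j < r → 1 ≤ c → c ≤ len i → c ≤ len j →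
              len j ≤ len i →
              (ent j c < ent i c) ⊎ (ent i (c ∸ 1) < ent j c)
      ct3-< : ∀ i j c → i < j → j < r → 1 ≤ c → c ≤ len i → c ≤ len j →
              len i < len j →
              (ent j c < ent i c) ⊎ (ent i c < ent j (suc c))
      lr4 : ReverseLattice k readingWord

module Submission where

-- Row i of the padded β receives λ_(rankβ i) new cells, where rankβ ranks the rows by length.
-- The entry order ranks the rows by new length instead, upper rows first; it still sorts
-- the rows by decreasing number of new cells, and since sorting a multiset is unique, the row
-- with entry k + 1 - j carries exactly λ_(k+1-j) new cells, which is (LR2).  (CT1) and (CT3)
-- hold because the β entries exceed k and decrease downwards, whereas the new entries
-- decrease along the entry order.  For (LR4), the rows p of v and q of v - 1 are consecutive
-- in the entry order, so q is not longer than p and has no more new cells, and when equally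
-- long it lies below p with a β part at least as long; reading the columns from right to
-- left, the cells of q are therefore never ahead of those of p.

open import Defs
open import Data.Nat
open import Data.Nat.Properties
open import Algebra.Properties.CommutativeSemigroup +-commutativeSemigroup using (interchange; xy∙z≈y∙xz)
open import Data.Bool using (Bool; true; false; _∧_; _∨_; not; T)
open import Data.Bool.Properties using (T-∧; T-∨; T-not-≡; ∧-zeroʳ; ∧-identityʳ; ∨-identityʳ)
open import Data.Empty using (⊥-elim)
open import Data.Product using (∃; _×_; _,_; proj₁; proj₂)
open import Data.Sum using (_⊎_; inj₁; inj₂; [_,_]′)
open import Data.List using (List; []; _∷_; length; map; upTo; applyUpTo; downFrom; replicate; _++_; concat; foldr; take; filterᵇ; [_])
open import Data.List.Properties using (upTo-∷ʳ; map-++; map-upTo; map-∘; map-cong-local; length-++; length-replicate; length-map; length-upTo; filter-++; take-map; take-[]; ++-identityʳ)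
open import Data.Nat.ListAction using (sum)
open import Data.Nat.ListAction.Properties using (sum-++)
open import Data.List.Relation.Unary.All using (All; []; _∷_)
open import Data.List.Relation.Unary.All.Properties using (applyUpTo⁺₁; concat⁺; map⁺; replicate⁺)
open import Function using (id; _∘_)
open import Function.Bundles using (Equivalence)
open import Relation.Binary.PropositionalEquality hiding ([_])
open import Relation.Nullary using (¬_; yes; no)
open import Relation.Binary using (tri<; tri≈; tri>)

open Equivalence using (to; from)

T⇒≡true : ∀ {b} → T b → b ≡ true
T⇒≡true {true} _ = refl

¬T⇒≡false : ∀ {b} → ¬ T b → b ≡ false
¬T⇒≡false {true} ¬t = ⊥-elim (¬t _)
¬T⇒≡false {false} _ = refl

T-injective : ∀ {x y} → (T x → T y) → (T y → T x) → x ≡ y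
T-injective {true} {true} _ _ = refl
T-injective {true} {false} f _ = ⊥-elim (f _)
T-injective {false} {true} _ g = ⊥-elim (g _)
T-injective {false} {false} _ _ = refl

bit : Bool → ℕ
bit true = 1
bit false = 0

bit-mono : ∀ {x y} → (T x → T y) → bit x ≤ bit y
bit-mono {true} {true} _ = ≤-refl
bit-mono {true} {false} f = ⊥-elim (f _)
bit-mono {false} _ = z≤n

count : (ℕ → Bool) → ℕ → ℕ
count p zero = 0
count p (suc n) = count p n + bit (p n)

module _ (p q : ℕ → Bool) where

  count-cong : ∀ n → (∀ x → x < n → p x ≡ q x) → count p n ≡ count q n
  count-cong zero _ = refl
  count-cong (suc n) p≡q = cong₂ _+_ (count-cong n (λ x x<n → p≡q x (m<n⇒m<1+n x<n)))
                                     (cong bit (p≡q n ≤-refl))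

  count-mono : ∀ n → (∀ x → x < n → T (p x) → T (q x)) → count p n ≤ count q n
  count-mono zero _ = z≤n
  count-mono (suc n) p⇒q = +-mono-≤ (count-mono n (λ x x<n → p⇒q x (m<n⇒m<1+n x<n)))
                                    (bit-mono (p⇒q n ≤-refl))

  count-mono-< : ∀ n a → (∀ x → x < n → T (p x) → T (q x)) → a < n → T (q a) → ¬ T (p a) →
                 count p n < count q n
  count-mono-< (suc n) a p⇒q a<1+n qa ¬pa with m<1+n⇒m<n∨m≡n a<1+n
  ... | inj₁ a<n = +-mono-<-≤ (count-mono-< n a p⇒q′ a<n qa ¬pa) (bit-mono (p⇒q n ≤-refl))
    where p⇒q′ = λ x x<n → p⇒q x (m<n⇒m<1+n x<n)
  ... | inj₂ refl rewrite T⇒≡true qa | ¬T⇒≡false ¬pa =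
    subst (_< count q a + 1) (sym (+-identityʳ (count p a)))
          (≤-<-trans (count-mono a (λ x x<a → p⇒q x (m<n⇒m<1+n x<a))) (m<m+n _ z<s))

count-true : ∀ n → count (λ _ → true) n ≡ n
count-true zero = refl
count-true (suc n) = trans (cong (_+ 1) (count-true n)) (+-comm n 1)

count-< : ∀ p n a → a < n → ¬ T (p a) → count p n < n
count-< p n a a<n ¬pa =
  subst (count p n <_) (count-true n) (count-mono-< p _ n a (λ _ _ _ → _) a<n _ ¬pa)

count-complement : ∀ p n → count p n + count (not ∘ p) n ≡ n
count-complement p zero = refl
count-complement p (suc n) with p n | count-complement p n
... | true | ih rewrite +-identityʳ (count (not ∘ p) n) | +-comm (count p n) 1 = cong suc ih
... | false | ih rewrite +-identityʳ (count p n) | +-comm (count (not ∘ p) n) 1 =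
  trans (+-suc (count p n) _) (cong suc ih)

count-≥ : ∀ lo n → count (lo ≤ᵇ_) n ≡ n ∸ lo
count-≥ lo zero = sym (0∸n≡0 lo)
count-≥ lo (suc n) with lo ≤? n
... | yes lo≤n rewrite count-≥ lo n | T⇒≡true (≤⇒≤ᵇ lo≤n) =
  trans (+-comm (n ∸ lo) 1) (sym (+-∸-assoc 1 lo≤n))
... | no lo≰n rewrite count-≥ lo n | ¬T⇒≡false (lo≰n ∘ ≤ᵇ⇒≤ lo n) =
  trans (+-identityʳ _) (trans (m≤n⇒m∸n≡0 (≤-trans (n≤1+n n) (≰⇒> lo≰n)))
                               (sym (m≤n⇒m∸n≡0 (≰⇒> lo≰n))))

count-remove : ∀ q v n → v < n → T (q v) → suc (count (λ u → q u ∧ not (u ≡ᵇ v)) n) ≡ count q n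
count-remove q v (suc n) v<1+n qv with m<1+n⇒m<n∨m≡n v<1+n
... | inj₁ v<n rewrite ¬T⇒≡false (<⇒≢ v<n ∘ sym ∘ ≡ᵇ⇒≡ n v) | ∧-identityʳ (q n) =
  cong (_+ bit (q n)) (count-remove q v n v<n qv)
... | inj₂ refl rewrite T⇒≡true (≡⇒≡ᵇ v v refl) | ∧-zeroʳ (q v) | T⇒≡true qv =
  trans (cong suc (trans (+-identityʳ _) (count-cong _ q v below))) (+-comm 1 _)
  where
  below : ∀ x → x < v → q x ∧ not (x ≡ᵇ v) ≡ q x
  below x x<v rewrite ¬T⇒≡false (<⇒≢ x<v ∘ ≡ᵇ⇒≡ x v) = ∧-identityʳ (q x)

count-≤-injection : ∀ p q (f : ℕ → ℕ) n m →
  (∀ x → x < n → T (p x) → f x < m × T (q (f x))) →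
  (∀ x y → x < n → y < n → T (p x) → T (p y) → f x ≡ f y → x ≡ y) →
  count p n ≤ count q m
count-≤-injection p q f zero m _ _ = z≤n
count-≤-injection p q f (suc n) m maps inj with p n in pn
... | false = subst (_≤ count q m) (sym (+-identityʳ _))
                    (count-≤-injection p q f n m (λ x x<n → maps x (m<n⇒m<1+n x<n))
                      (λ x y x<n y<n → inj x y (m<n⇒m<1+n x<n) (m<n⇒m<1+n y<n)))
... | true = subst₂ _≤_ (+-comm 1 _) (count-remove q (f n) m fn<m qfn)
                    (s≤s (count-≤-injection p q′ f n m maps′
                      (λ x y x<n y<n → inj x y (m<n⇒m<1+n x<n) (m<n⇒m<1+n y<n))))
  where
  pn′ : T (p n)
  pn′ = subst T (sym pn) _
  fn<m = proj₁ (maps n ≤-refl pn′)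
  qfn = proj₂ (maps n ≤-refl pn′)
  q′ = λ u → q u ∧ not (u ≡ᵇ f n)
  maps′ : ∀ x → x < n → T (p x) → f x < m × T (q′ (f x))
  maps′ x x<n px = proj₁ (maps x (m<n⇒m<1+n x<n) px) ,
    from T-∧ (proj₂ (maps x (m<n⇒m<1+n x<n) px) ,
              from T-not-≡ (¬T⇒≡false (<⇒≢ x<n ∘ inj x n (m<n⇒m<1+n x<n) ≤-refl px pn′ ∘ ≡ᵇ⇒≡ _ _)))

count-∧-≡ᵇ-out : ∀ (p : ℕ → Bool) w m → m ≤ w → count (λ i → p i ∧ (i ≡ᵇ w)) m ≡ 0
count-∧-≡ᵇ-out p w zero _ = refl
count-∧-≡ᵇ-out p w (suc m) m<w rewrite ¬T⇒≡false (<⇒≢ m<w ∘ ≡ᵇ⇒≡ m w) | ∧-zeroʳ (p m) =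
  trans (+-identityʳ _) (count-∧-≡ᵇ-out p w m (<⇒≤ m<w))

count-∧-≡ᵇ-in : ∀ (p : ℕ → Bool) w m → w < m → count (λ i → p i ∧ (i ≡ᵇ w)) m ≡ bit (p w)
count-∧-≡ᵇ-in p w (suc m) w<1+m with m<1+n⇒m<n∨m≡n w<1+m
... | inj₁ w<m rewrite ¬T⇒≡false (<⇒≢ w<m ∘ sym ∘ ≡ᵇ⇒≡ m w) | ∧-zeroʳ (p m) =
  trans (+-identityʳ _) (count-∧-≡ᵇ-in p w m w<m)
... | inj₂ refl rewrite T⇒≡true (≡⇒≡ᵇ w w refl) | ∧-identityʳ (p w) =
  cong (_+ bit (p w)) (count-∧-≡ᵇ-out p w w ≤-refl)

count-∧-≡ᵇ≤ : ∀ (p : ℕ → Bool) w m → count (λ i → p i ∧ (i ≡ᵇ w)) m ≤ bit (p w)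
count-∧-≡ᵇ≤ p w m with w <? m
... | yes w<m = ≤-reflexive (count-∧-≡ᵇ-in p w m w<m)
... | no w≮m = subst (_≤ bit (p w)) (sym (count-∧-≡ᵇ-out p w m (≮⇒≥ w≮m))) z≤n

record IsStrictTotalᵇ (R : ℕ → ℕ → Bool) : Set where
  field
    irrefl    : ∀ a → ¬ T (R a a)
    trans′    : ∀ a b c → T (R a b) → T (R b c) → T (R a c)
    connected : ∀ a b → a ≢ b → T (R a b) ⊎ T (R b a)

<ᵇ-isStrictTotal : IsStrictTotalᵇ _<ᵇ_
<ᵇ-isStrictTotal = record
  { irrefl    = λ a → <-irrefl refl ∘ <ᵇ⇒< a a
  ; trans′    = λ a b c ab bc → <⇒<ᵇ (<-trans (<ᵇ⇒< a b ab) (<ᵇ⇒< b c bc))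
  ; connected = connected
  }
  where
  connected : ∀ a b → a ≢ b → T (a <ᵇ b) ⊎ T (b <ᵇ a)
  connected a b a≢b with <-cmp a b
  ... | tri< a<b _ _ = inj₁ (<⇒<ᵇ a<b)
  ... | tri≈ _ a≡b _ = ⊥-elim (a≢b a≡b)
  ... | tri> _ _ b<a = inj₂ (<⇒<ᵇ b<a)

>ᵇ-isStrictTotal : IsStrictTotalᵇ (λ a b → b <ᵇ a)
>ᵇ-isStrictTotal = record
  { irrefl    = irrefl
  ; trans′    = λ a b c ab bc → trans′ c b a bc ab
  ; connected = λ a b a≢b → connected b a (a≢b ∘ sym)
  }
  where open IsStrictTotalᵇ <ᵇ-isStrictTotal

byDecreasing : (ℕ → ℕ) → (ℕ → ℕ → Bool) → ℕ → ℕ → Bool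
byDecreasing g t a b = (g b <ᵇ g a) ∨ ((g a ≡ᵇ g b) ∧ t a b)

module ByDecreasing (g : ℕ → ℕ) {t : ℕ → ℕ → Bool} (t-isStrictTotal : IsStrictTotalᵇ t) where
  open IsStrictTotalᵇ t-isStrictTotal

  L : ℕ → ℕ → Bool
  L = byDecreasing g t

  view : ∀ a b → T (L a b) → g b < g a ⊎ (g a ≡ g b × T (t a b))
  view a b h with to T-∨ h
  ... | inj₁ gb<ga = inj₁ (<ᵇ⇒< _ _ gb<ga)
  ... | inj₂ h′ = inj₂ (≡ᵇ⇒≡ _ _ (proj₁ (to T-∧ h′)) , proj₂ (to T-∧ h′))

  >⇒L : ∀ a b → g b < g a → T (L a b)
  >⇒L a b gb<ga = from T-∨ (inj₁ (<⇒<ᵇ gb<ga))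

  ≡∧t⇒L : ∀ a b → g a ≡ g b → T (t a b) → T (L a b)
  ≡∧t⇒L a b ga≡gb tab = from T-∨ (inj₂ (from T-∧ (≡⇒≡ᵇ _ _ ga≡gb , tab)))

  L⇒≥ : ∀ a b → T (L a b) → g b ≤ g a
  L⇒≥ a b h with view a b h
  ... | inj₁ gb<ga = <⇒≤ gb<ga
  ... | inj₂ (ga≡gb , _) = ≤-reflexive (sym ga≡gb)

  isStrictTotal : IsStrictTotalᵇ L
  isStrictTotal = record { irrefl = irrefl′ ; trans′ = trans″ ; connected = connected′ }
    where
    irrefl′ : ∀ a → ¬ T (L a a)
    irrefl′ a h with view a a h
    ... | inj₁ ga<ga = <-irrefl refl ga<ga
    ... | inj₂ (_ , taa) = irrefl a taa

    trans″ : ∀ a b c → T (L a b) → T (L b c) → T (L a c)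
    trans″ a b c ab bc with view a b ab | view b c bc
    ... | inj₁ gb<ga | inj₁ gc<gb = >⇒L a c (<-trans gc<gb gb<ga)
    ... | inj₁ gb<ga | inj₂ (gb≡gc , _) = >⇒L a c (subst (_< g a) gb≡gc gb<ga)
    ... | inj₂ (ga≡gb , _) | inj₁ gc<gb = >⇒L a c (subst (g c <_) (sym ga≡gb) gc<gb)
    ... | inj₂ (ga≡gb , tab) | inj₂ (gb≡gc , tbc) = ≡∧t⇒L a c (trans ga≡gb gb≡gc) (trans′ a b c tab tbc)

    connected′ : ∀ a b → a ≢ b → T (L a b) ⊎ T (L b a)
    connected′ a b a≢b with <-cmp (g a) (g b)
    ... | tri< ga<gb _ _ = inj₂ (>⇒L b a ga<gb)
    ... | tri> _ _ gb<ga = inj₁ (>⇒L a b gb<ga)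
    ... | tri≈ _ ga≡gb _ with connected a b a≢b
    ... | inj₁ tab = inj₁ (≡∧t⇒L a b ga≡gb tab)
    ... | inj₂ tba = inj₂ (≡∧t⇒L b a (sym ga≡gb) tba)

module Rank {R : ℕ → ℕ → Bool} (R-isStrictTotal : IsStrictTotalᵇ R) (r : ℕ) where
  open IsStrictTotalᵇ R-isStrictTotal

  rank : ℕ → ℕ
  rank i = suc (count (λ a → R a i) r)

  rank-mono : ∀ a b → a < r → T (R a b) → rank a < rank b
  rank-mono a b a<r ab =
    s≤s (count-mono-< _ _ r a (λ x _ xa → trans′ x a b xa ab) a<r ab (irrefl a))

  rank≤ : ∀ i → i < r → rank i ≤ r
  rank≤ i i<r = count-< _ r i i<r (irrefl i)

  rank-injective : ∀ a b → a < r → b < r → rank a ≡ rank b → a ≡ b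
  rank-injective a b a<r b<r ra≡rb with a ≟ b
  ... | yes a≡b = a≡b
  ... | no a≢b with connected a b a≢b
  ... | inj₁ ab = ⊥-elim (<-irrefl ra≡rb (rank-mono a b a<r ab))
  ... | inj₂ ba = ⊥-elim (<-irrefl (sym ra≡rb) (rank-mono b a b<r ba))

  rank-reflects : ∀ a b → a < r → b < r → rank a < rank b → T (R a b)
  rank-reflects a b a<r b<r ra<rb with a ≟ b
  ... | yes refl = ⊥-elim (<-irrefl refl ra<rb)
  ... | no a≢b with connected a b a≢b
  ... | inj₁ ab = ab
  ... | inj₂ ba = ⊥-elim (<-asym ra<rb (rank-mono b a b<r ba))

  -- Otherwise rank would inject 0, …, r-1 into the r-1 values {1, …, r} minus m.
  rank-surjective : ∀ m → 1 ≤ m → m ≤ r → ∃ λ p → p < r × rank p ≡ m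
  rank-surjective m 1≤m m≤r with anyUpTo? (λ p → rank p ≟ m) r
  ... | yes (p , p<r , rp≡m) = p , p<r , rp≡m
  ... | no none = ⊥-elim (<-irrefl refl (≤-trans (≤-reflexive others) r≤))
    where
    q : ℕ → Bool
    q w = (1 ≤ᵇ w) ∧ not (w ≡ᵇ m)
    r≤ : r ≤ count q (suc r)
    r≤ = subst (_≤ count q (suc r)) (count-true r)
      (count-≤-injection _ q rank r (suc r)
        (λ x x<r _ → s≤s (rank≤ x x<r) ,
                     from T-∧ (_ , from T-not-≡ (¬T⇒≡false (λ t → none (x , x<r , ≡ᵇ⇒≡ _ _ t)))))
        (λ x y x<r y<r _ _ → rank-injective x y x<r y<r))
    others : suc (count q (suc r)) ≡ r
    others = trans (count-remove (1 ≤ᵇ_) m (suc r) (s≤s m≤r) (≤⇒≤ᵇ 1≤m)) (count-≥ 1 (suc r))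

get-antitone : ∀ {la} → Decreasing la → ∀ {m n} → m ≤ n → get la n ≤ get la m
get-antitone {la} dec {m} m≤n with m≤n⇒∃[o]m+o≡n m≤n
... | o , refl = go o
  where
  step : ∀ {xs} → Decreasing xs → ∀ i → get xs (suc i) ≤ get xs i
  step dec-[] _ = z≤n
  step dec-[x] zero = z≤n
  step dec-[x] (suc _) = z≤n
  step (dec-∷ x≥y _) zero = x≥y
  step (dec-∷ _ d) (suc i) = step d i
  go : ∀ o → get la (m + o) ≤ get la m
  go zero = ≤-reflexive (cong (get la) (+-identityʳ m))
  go (suc o) = ≤-trans (≤-reflexive (cong (get la) (+-suc m o))) (≤-trans (step dec (m + o)) (go o))

at-antitone : ∀ {la} → Decreasing la → ∀ {m n} → 1 ≤ m → m ≤ n → at la n ≤ at la m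
at-antitone dec {suc m} {suc n} _ (s≤s m≤n) = get-antitone dec m≤n

-- If a = λ ∘ ρ for an antitone λ and an injection ρ into {1, …, r}, then ranking by any
-- order that puts larger values of a first gives a = λ ∘ rank.
module RankSorts {R : ℕ → ℕ → Bool} (R-isStrictTotal : IsStrictTotalᵇ R) (r : ℕ)
  {la : List ℕ} (la-dec : Decreasing la) (ρ : ℕ → ℕ) (1≤ρ : ∀ i → 1 ≤ ρ i)
  (ρ≤r : ∀ i → i < r → ρ i ≤ r) (ρ-injective : ∀ x y → x < r → y < r → ρ x ≡ ρ y → x ≡ y)
  (R-sorts : ∀ x y → x < r → y < r → T (R x y) → at la (ρ y) ≤ at la (ρ x))
  where
  open IsStrictTotalᵇ R-isStrictTotal
  open Rank R-isStrictTotal r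

  private
    a : ℕ → ℕ
    a i = at la (ρ i)

    c : ℕ → ℕ
    c p = count (λ j → R j p) r

  at-rank≤ : ∀ p → p < r → a p ≤ at la (rank p)
  at-rank≤ p p<r with a p ≤? at la (rank p)
  ... | yes ≤λ = ≤λ
  ... | no ≰λ = ⊥-elim (<-irrefl refl (≤-trans atLeast (≤-reflexive (count-≥ 1 (rank p)))))
    where
    atOrBefore : ℕ → Bool
    atOrBefore j = R j p ∨ (j ≡ᵇ p)
    above : ∀ x → x < r → T (atOrBefore x) → a p ≤ a x
    above x x<r h with to T-∨ h
    ... | inj₁ xp = R-sorts x p x<r p<r xp
    ... | inj₂ x≡p rewrite ≡ᵇ⇒≡ x p x≡p = ≤-refl
    ρ<rank : ∀ x → x < r → T (atOrBefore x) → ρ x < rank p × T (1 ≤ᵇ ρ x)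
    ρ<rank x x<r h = ≰⇒> (λ rank≤ρ → ≰λ (≤-trans (above x x<r h) (at-antitone la-dec (s≤s z≤n) rank≤ρ)))
                   , ≤⇒≤ᵇ (1≤ρ x)
    atLeast : rank p ≤ count (1 ≤ᵇ_) (rank p)
    atLeast = ≤-trans (count-mono-< _ atOrBefore r p (λ _ _ → from T-∨ ∘ inj₁) p<r
                                    (from T-∨ (inj₂ (≡⇒≡ᵇ p p refl))) (irrefl p))
                      (count-≤-injection atOrBefore (1 ≤ᵇ_) ρ r (rank p) ρ<rank
                                         (λ x y x<r y<r _ _ → ρ-injective x y x<r y<r))

  at-rank≥ : ∀ p → p < r → at la (rank p) ≤ a p
  at-rank≥ p p<r with at la (rank p) ≤? a p
  ... | yes λ≤ = λ≤
  ... | no λ≰ = ⊥-elim (<-irrefl refl (≤-trans (+-monoʳ-≤ (rank p) atMost) (≤-reflexive split)))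
    where
    notBefore : ℕ → Bool
    notBefore j = not (R j p)
    below : ∀ x → x < r → T (notBefore x) → a x ≤ a p
    below x x<r h with x ≟ p
    ... | yes refl = ≤-refl
    ... | no x≢p with connected x p x≢p
    ... | inj₁ xp = ⊥-elim (subst T (to T-not-≡ h) xp)
    ... | inj₂ px = R-sorts p x p<r x<r px
    rank<ρ : ∀ x → x < r → T (notBefore x) → ρ x < suc r × T (suc (rank p) ≤ᵇ ρ x)
    rank<ρ x x<r h = s≤s (ρ≤r x x<r)
                   , ≤⇒≤ᵇ (≰⇒> (λ ρ≤rank → λ≰ (≤-trans (at-antitone la-dec (1≤ρ x) ρ≤rank) (below x x<r h))))
    atMost : count notBefore r ≤ r ∸ rank p
    atMost = ≤-trans (count-≤-injection notBefore _ ρ r (suc r) rank<ρ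
                                        (λ x y x<r y<r _ _ → ρ-injective x y x<r y<r))
                     (≤-reflexive (count-≥ (suc (rank p)) (suc r)))
    split : rank p + (r ∸ rank p) ≡ c p + count notBefore r
    split = trans (m+[n∸m]≡n (rank≤ p p<r)) (sym (count-complement _ r))

  at-rank : ∀ p → p < r → a p ≡ at la (rank p)
  at-rank p p<r = ≤-antisym (at-rank≤ p p<r) (at-rank≥ p p<r)

sumBelow : (ℕ → ℕ) → ℕ → ℕ
sumBelow f n = sum (map f (upTo n))

sumBelow-suc : ∀ f n → sumBelow f (suc n) ≡ sumBelow f n + f n
sumBelow-suc f n = begin
  sum (map f (upTo (suc n)))           ≡⟨ cong (sum ∘ map f) (sym (upTo-∷ʳ n)) ⟩
  sum (map f (upTo n ++ [ n ]))        ≡⟨ cong sum (map-++ f (upTo n) [ n ]) ⟩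
  sum (map f (upTo n) ++ [ f n ])      ≡⟨ sum-++ (map f (upTo n)) [ f n ] ⟩
  sumBelow f n + (f n + 0)             ≡⟨ cong (sumBelow f n +_) (+-identityʳ (f n)) ⟩
  sumBelow f n + f n                   ∎
  where open ≡-Reasoning

sumBelow-cons : ∀ f n → sumBelow f (suc n) ≡ f 0 + sumBelow (λ t → f (suc t)) n
sumBelow-cons f n =
  cong sum (trans (map-upTo f (suc n)) (cong (f 0 ∷_) (sym (map-upTo (λ t → f (suc t)) n))))

sumBelow-cong : ∀ {f g} n → (∀ i → i < n → f i ≡ g i) → sumBelow f n ≡ sumBelow g n
sumBelow-cong zero _ = refl
sumBelow-cong {f} {g} (suc n) f≡g = begin
  sumBelow f (suc n)   ≡⟨ sumBelow-suc f n ⟩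
  sumBelow f n + f n   ≡⟨ cong₂ _+_ (sumBelow-cong n (λ i i<n → f≡g i (m<n⇒m<1+n i<n))) (f≡g n ≤-refl) ⟩
  sumBelow g n + g n   ≡⟨ sumBelow-suc g n ⟨
  sumBelow g (suc n)   ∎
  where open ≡-Reasoning

sumBelow-+ : ∀ f g n → sumBelow (λ i → f i + g i) n ≡ sumBelow f n + sumBelow g n
sumBelow-+ f g zero = refl
sumBelow-+ f g (suc n) = begin
  sumBelow (λ i → f i + g i) (suc n)          ≡⟨ sumBelow-suc _ n ⟩
  sumBelow (λ i → f i + g i) n + (f n + g n)  ≡⟨ cong (_+ (f n + g n)) (sumBelow-+ f g n) ⟩
  (sumBelow f n + sumBelow g n) + (f n + g n) ≡⟨ interchange (sumBelow f n) _ _ _ ⟩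
  (sumBelow f n + f n) + (sumBelow g n + g n) ≡⟨ cong₂ _+_ (sumBelow-suc f n) (sumBelow-suc g n) ⟨
  sumBelow f (suc n) + sumBelow g (suc n)     ∎
  where open ≡-Reasoning

sumBelow-zero : ∀ f n → (∀ i → i < n → f i ≡ 0) → sumBelow f n ≡ 0
sumBelow-zero f zero _ = refl
sumBelow-zero f (suc n) f≡0 = begin
  sumBelow f (suc n) ≡⟨ sumBelow-suc f n ⟩
  sumBelow f n + f n ≡⟨ cong₂ _+_ (sumBelow-zero f n (λ i i<n → f≡0 i (m<n⇒m<1+n i<n))) (f≡0 n ≤-refl) ⟩
  0                  ∎
  where open ≡-Reasoning

sumBelow-single : ∀ f n p → p < n → (∀ i → i < n → i ≢ p → f i ≡ 0) → sumBelow f n ≡ f p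
sumBelow-single f (suc n) p p<1+n f≡0 with m<1+n⇒m<n∨m≡n p<1+n
... | inj₁ p<n = begin
  sumBelow f (suc n) ≡⟨ sumBelow-suc f n ⟩
  sumBelow f n + f n ≡⟨ cong₂ _+_ (sumBelow-single f n p p<n (λ i i<n → f≡0 i (m<n⇒m<1+n i<n)))
                                  (f≡0 n ≤-refl (<⇒≢ p<n ∘ sym)) ⟩
  f p + 0            ≡⟨ +-identityʳ (f p) ⟩
  f p                ∎
  where open ≡-Reasoning
... | inj₂ refl = begin
  sumBelow f (suc p) ≡⟨ sumBelow-suc f p ⟩
  sumBelow f p + f p ≡⟨ cong (_+ f p) (sumBelow-zero f p (λ i i<p → f≡0 i (m<n⇒m<1+n i<p) (<⇒≢ i<p))) ⟩
  f p                ∎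
  where open ≡-Reasoning

sumBelow-reverse : ∀ (f : ℕ → ℕ) n → sumBelow (λ t → f (n ∸ t)) n ≡ sumBelow (λ t → f (suc t)) n
sumBelow-reverse f zero = refl
sumBelow-reverse f (suc n) = begin
  sumBelow (λ t → f (suc n ∸ t)) (suc n)   ≡⟨ sumBelow-cons (λ t → f (suc n ∸ t)) n ⟩
  f (suc n) + sumBelow (λ t → f (n ∸ t)) n ≡⟨ cong (f (suc n) +_) (sumBelow-reverse f n) ⟩
  f (suc n) + sumBelow (λ t → f (suc t)) n         ≡⟨ +-comm (f (suc n)) _ ⟩
  sumBelow (λ t → f (suc t)) n + f (suc n)         ≡⟨ sumBelow-suc (λ t → f (suc t)) n ⟨
  sumBelow (λ t → f (suc t)) (suc n)               ∎
  where open ≡-Reasoning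

sumBelow-get : ∀ xs → sumBelow (get xs) (length xs) ≡ sum xs
sumBelow-get [] = refl
sumBelow-get (x ∷ xs) = trans (sumBelow-cons (get (x ∷ xs)) (length xs)) (cong (x +_) (sumBelow-get xs))

countᵇ-++ : ∀ {A : Set} (p : A → Bool) xs ys → countᵇ p (xs ++ ys) ≡ countᵇ p xs + countᵇ p ys
countᵇ-++ p [] ys = refl
countᵇ-++ p (x ∷ xs) ys with p x
... | true = cong suc (countᵇ-++ p xs ys)
... | false = countᵇ-++ p xs ys

countᵇ-∷ : ∀ {A : Set} (p : A → Bool) x xs → countᵇ p (x ∷ xs) ≡ bit (p x) + countᵇ p xs
countᵇ-∷ p x xs with p x
... | true = refl
... | false = refl

countᵇ-upTo : ∀ p n → countᵇ p (upTo n) ≡ count p n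
countᵇ-upTo p zero = refl
countᵇ-upTo p (suc n) = begin
  countᵇ p (upTo (suc n))             ≡⟨ cong (countᵇ p) (sym (upTo-∷ʳ n)) ⟩
  countᵇ p (upTo n ++ [ n ])          ≡⟨ countᵇ-++ p (upTo n) [ n ] ⟩
  countᵇ p (upTo n) + countᵇ p [ n ]  ≡⟨ cong₂ _+_ (countᵇ-upTo p n) (trans (countᵇ-∷ p n []) (+-identityʳ _)) ⟩
  count p n + bit (p n)               ∎
  where open ≡-Reasoning

countᵇ-map-filterᵇ : ∀ (p : ℕ → Bool) (g : ℕ → ℕ) (q : ℕ → Bool) xs →
  countᵇ p (map g (filterᵇ q xs)) ≡ countᵇ (λ i → q i ∧ p (g i)) xs
countᵇ-map-filterᵇ p g q [] = refl
countᵇ-map-filterᵇ p g q (x ∷ xs) with q x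
... | false = countᵇ-map-filterᵇ p g q xs
... | true with p (g x)
...   | true = cong suc (countᵇ-map-filterᵇ p g q xs)
...   | false = countᵇ-map-filterᵇ p g q xs

occ-concat-upTo : ∀ j (F : ℕ → List ℕ) n → occ j (concat (map F (upTo n))) ≡ sumBelow (occ j ∘ F) n
occ-concat-upTo j F n = trans (go (map F (upTo n))) (cong sum (sym (map-∘ (upTo n))))
  where
  go : ∀ xss → occ j (concat xss) ≡ sum (map (occ j) xss)
  go [] = refl
  go (xs ∷ xss) = trans (countᵇ-++ _ xs (concat xss)) (cong (occ j xs +_) (go xss))

occ-replicate-≡ : ∀ j n → occ j (replicate n j) ≡ n
occ-replicate-≡ j zero = refl
occ-replicate-≡ j (suc n) rewrite T⇒≡true (≡⇒≡ᵇ j j refl) = cong suc (occ-replicate-≡ j n)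

occ-replicate-≢ : ∀ j n x → x ≢ j → occ j (replicate n x) ≡ 0
occ-replicate-≢ j zero x _ = refl
occ-replicate-≢ j (suc n) x x≢j rewrite ¬T⇒≡false (x≢j ∘ ≡ᵇ⇒≡ x j) = occ-replicate-≢ j n x x≢j

length≡sumBelow-occ : ∀ k xs → All (λ x → 1 ≤ x × x ≤ k) xs →
                      length xs ≡ sumBelow (λ t → occ (suc t) xs) k
length≡sumBelow-occ k [] [] = sym (sumBelow-zero _ k (λ _ _ → refl))
length≡sumBelow-occ k (suc p ∷ xs) ((_ , p<k) ∷ xs-letters) = begin
  suc (length xs)
    ≡⟨ cong₂ _+_ (sym onlyAt-p) (length≡sumBelow-occ k xs xs-letters) ⟩
  sumBelow (λ t → bit (suc p ≡ᵇ suc t)) k + sumBelow (λ t → occ (suc t) xs) k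
    ≡⟨ sumBelow-+ _ _ k ⟨
  sumBelow (λ t → bit (suc p ≡ᵇ suc t) + occ (suc t) xs) k
    ≡⟨ sumBelow-cong k (λ t _ → sym (countᵇ-∷ _ (suc p) xs)) ⟩
  sumBelow (λ t → occ (suc t) (suc p ∷ xs)) k
    ∎
  where
  open ≡-Reasoning
  onlyAt-p : sumBelow (λ t → bit (suc p ≡ᵇ suc t)) k ≡ 1
  onlyAt-p = trans (sumBelow-single _ k p p<k
                     (λ t _ t≢p → cong bit (¬T⇒≡false (t≢p ∘ sym ∘ ≡ᵇ⇒≡ p t))))
                   (cong bit (T⇒≡true (≡⇒≡ᵇ p p refl)))

get-replicate-++ˡ : ∀ n (x : ℕ) ys c → c < n → get (replicate n x ++ ys) c ≡ x
get-replicate-++ˡ (suc n) x ys zero _ = refl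
get-replicate-++ˡ (suc n) x ys (suc c) (s≤s c<n) = get-replicate-++ˡ n x ys c c<n

get-replicate-++ʳ : ∀ n (x : ℕ) ys c → get (replicate n x ++ ys) (n + c) ≡ get ys c
get-replicate-++ʳ zero x ys c = refl
get-replicate-++ʳ (suc n) x ys c = get-replicate-++ʳ n x ys c

at-replicate-++ˡ : ∀ b (x : ℕ) a y c → 1 ≤ c → c ≤ b → at (replicate b x ++ replicate a y) c ≡ x
at-replicate-++ˡ b x a y (suc c) _ c<b = get-replicate-++ˡ b x _ c c<b

at-replicate-++ʳ : ∀ b (x : ℕ) a y c → b < c → c ≤ b + a → at (replicate b x ++ replicate a y) c ≡ y
at-replicate-++ʳ b x a y (suc c) (s≤s b≤c) c<b+a with m≤n⇒∃[o]m+o≡n b≤c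
... | d , refl = begin
  get (replicate b x ++ replicate a y) (b + d) ≡⟨ get-replicate-++ʳ b x (replicate a y) d ⟩
  get (replicate a y) d                       ≡⟨ cong (λ ys → get ys d) (++-identityʳ (replicate a y)) ⟨
  get (replicate a y ++ []) d                 ≡⟨ get-replicate-++ˡ a y [] d (+-cancelˡ-< b d a c<b+a) ⟩
  y                                           ∎
  where open ≡-Reasoning

length-replicate-++ : ∀ b (x : ℕ) a y → length (replicate b x ++ replicate a y) ≡ b + a
length-replicate-++ b x a y =
  trans (length-++ (replicate b x)) (cong₂ _+_ (length-replicate b) (length-replicate a))

rowOf-map-upTo : ∀ (f : ℕ → List ℕ) n i → i < n → rowOf (map f (upTo n)) i ≡ f i
rowOf-map-upTo f n i i<n = go id n i i<n
  where
  go : ∀ (h : ℕ → ℕ) n i → i < n → rowOf (map f (applyUpTo h n)) i ≡ f (h i)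
  go h (suc n) zero _ = refl
  go h (suc n) (suc i) (s≤s i<n) = go (h ∘ suc) n i i<n

length-rowOf≤maxRow : ∀ (T : List (List ℕ)) i → i < length T →
                      length (rowOf T i) ≤ foldr _⊔_ 0 (map length T)
length-rowOf≤maxRow (t ∷ ts) zero _ = m≤m⊔n (length t) _
length-rowOf≤maxRow (t ∷ ts) (suc i) (s≤s i<) = ≤-trans (length-rowOf≤maxRow ts i i<) (m≤n⊔m (length t) _)

0<at⇒≤length : ∀ la m → 0 < at la m → m ≤ length la
0<at⇒≤length (_ ∷ _) (suc zero) _ = s≤s z≤n
0<at⇒≤length (_ ∷ la) (suc (suc m)) 0<at = s≤s (0<at⇒≤length la (suc m) 0<at)

map-upTo-const : ∀ (g : ℕ → ℕ) n y → (∀ t → t < n → g t ≡ y) → map g (upTo n) ≡ replicate n y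
map-upTo-const g n y g≡y = go id n (λ t t<n → g≡y t t<n)
  where
  go : ∀ (h : ℕ → ℕ) n → (∀ t → t < n → g (h t) ≡ y) → map g (applyUpTo h n) ≡ replicate n y
  go h zero _ = refl
  go h (suc n) g≡y = cong₂ _∷_ (g≡y 0 z<s) (go (h ∘ suc) n (λ t t<n → g≡y (suc t) (s<s t<n)))

map-cong-upTo : ∀ {A : Set} {f g : ℕ → A} n → (∀ i → i < n → f i ≡ g i) → map f (upTo n) ≡ map g (upTo n)
map-cong-upTo n f≡g = map-cong-local (applyUpTo⁺₁ id n (λ {i} i<n → f≡g i i<n))

replicate⁺-nonempty : ∀ {P : ℕ → Set} n {x} → (0 < n → P x) → All P (replicate n x)
replicate⁺-nonempty zero _ = []
replicate⁺-nonempty (suc n) Px = replicate⁺ (suc n) (Px z<s)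

numAppended≡length-appendedEntries : ∀ la β T → LR.numAppended la β T ≡ length (LR.appendedEntries la β T)
numAppended≡length-appendedEntries la β T = sym (begin
  length (concat (map row (upTo r)))   ≡⟨ length-concat (map row (upTo r)) ⟩
  sum (map length (map row (upTo r)))  ≡⟨ cong sum (map-∘ (upTo r)) ⟨
  sum (map (length ∘ row) (upTo r))    ≡⟨ cong sum (map-cong-upTo r (λ i _ → length-row i)) ⟩
  numAppended                          ∎)
  where
  open ≡-Reasoning
  open LR la β T
  row : ℕ → List ℕ
  row i = map (ent i) (rangeOC (get β i) (len i))
  length-row : ∀ i → length (row i) ≡ len i ∸ get β i
  length-row i = trans (length-map (ent i) (rangeOC (get β i) (len i)))
                       (trans (length-map (λ t → suc (get β i + t)) (upTo (len i ∸ get β i)))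
                              (length-upTo (len i ∸ get β i)))
  length-concat : ∀ (xss : List (List ℕ)) → length (concat xss) ≡ sum (map length xss)
  length-concat [] = refl
  length-concat (xs ∷ xss) = trans (length-++ xs) (cong (length xs +_) (length-concat xss))

take-++-cases : ∀ {A : Set} n (xs ys : List A) →
  take n (xs ++ ys) ≡ take n xs ⊎ ∃ λ n′ → take n (xs ++ ys) ≡ xs ++ take n′ ys
take-++-cases n [] ys = inj₂ (n , refl)
take-++-cases zero (x ∷ xs) ys = inj₁ refl
take-++-cases (suc n) (x ∷ xs) ys with take-++-cases n xs ys
... | inj₁ eq = inj₁ (cong (x ∷_) eq)
... | inj₂ (n′ , eq) = inj₂ (n′ , cong (x ∷_) eq)

filterᵇ-upTo-suc : ∀ (p : ℕ → Bool) r → filterᵇ p (upTo (suc r)) ≡ filterᵇ p (upTo r) ++ filterᵇ p [ r ]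
filterᵇ-upTo-suc p r = trans (cong (filterᵇ p) (sym (upTo-∷ʳ r))) (filter-++ _ (upTo r) [ r ])

take-filterᵇ-upTo : ∀ (p : ℕ → Bool) r n → ∃ λ m → m ≤ r × take n (filterᵇ p (upTo r)) ≡ filterᵇ p (upTo m)
take-filterᵇ-upTo p zero n = 0 , z≤n , take-[] n
take-filterᵇ-upTo p (suc r) n rewrite filterᵇ-upTo-suc p r
  with take-++-cases n (filterᵇ p (upTo r)) (filterᵇ p [ r ])
... | inj₁ eq with take-filterᵇ-upTo p r n
...   | m , m≤r , eq′ = m , m≤n⇒m≤1+n m≤r , trans eq eq′
take-filterᵇ-upTo p (suc r) n | inj₂ (zero , eq) = r , n≤1+n r , trans eq (++-identityʳ _)
take-filterᵇ-upTo p (suc r) n | inj₂ (suc n′ , eq) = suc r , ≤-refl ,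
  trans eq (trans (cong (filterᵇ p (upTo r) ++_) take-all-[r]) (sym (filterᵇ-upTo-suc p r)))
  where
  take-all-[r] : take (suc n′) (filterᵇ p [ r ]) ≡ filterᵇ p [ r ]
  take-all-[r] with p r
  ... | true = cong (r ∷_) (take-[] n′)
  ... | false = refl

-- the number of the columns b+1, …, b+a that lie to the right of column d
cellsAfter : ℕ → ℕ → ℕ → ℕ
cellsAfter b a d = (b + a ∸ d) ⊓ a

cellsAfter-0 : ∀ b a → cellsAfter b a 0 ≡ a
cellsAfter-0 b a = m≥n⇒m⊓n≡n (m≤n+m a b)

cellsAfter-end : ∀ b a d → b + a ≤ d → cellsAfter b a d ≡ 0
cellsAfter-end b a d b+a≤d rewrite m≤n⇒m∸n≡0 b+a≤d = refl

cellsAfter-step : ∀ b a d →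
  cellsAfter b a d ≡ bit ((b <ᵇ suc d) ∧ (suc d <ᵇ suc (b + a))) + cellsAfter b a (suc d)
cellsAfter-step zero a d rewrite m≤n⇒m⊓n≡m (m∸n≤m a d) | m≤n⇒m⊓n≡m (m∸n≤m a (suc d)) = go a d
  where
  go : ∀ a d → a ∸ d ≡ bit (d <ᵇ a) + (a ∸ suc d)
  go zero zero = refl
  go zero (suc d) = refl
  go (suc a) zero = refl
  go (suc a) (suc d) = go a d
cellsAfter-step (suc b) a zero = trans (m≥n⇒m⊓n≡n (m≤n+m a (suc b))) (sym (m≥n⇒m⊓n≡n (m≤n+m a b)))
cellsAfter-step (suc b) a (suc d) = cellsAfter-step b a d

module SuperFillingProperties (la β : List ℕ) (la-dec : Decreasing la) where
  open SuperFilling la β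

  βlen : ℕ → ℕ
  βlen = get β′

  module Longer = ByDecreasing βlen >ᵇ-isStrictTotal
  module LongerRank = Rank Longer.isStrictTotal r

  rankβ≡rank : ∀ i → rankβ i ≡ LongerRank.rank i
  rankβ≡rank i = cong suc (countᵇ-upTo (λ a → βlonger a i) r)

  rankβ-mono : ∀ x y → x < r → T (βlonger x y) → rankβ x < rankβ y
  rankβ-mono x y x<r xy = subst₂ _<_ (sym (rankβ≡rank x)) (sym (rankβ≡rank y)) (LongerRank.rank-mono x y x<r xy)

  rankβ-injective : ∀ x y → x < r → y < r → rankβ x ≡ rankβ y → x ≡ y
  rankβ-injective x y x<r y<r ρx≡ρy =
    LongerRank.rank-injective x y x<r y<r (trans (sym (rankβ≡rank x)) (trans ρx≡ρy (rankβ≡rank y)))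

  rankβ-reflects : ∀ x y → x < r → y < r → rankβ x < rankβ y → T (βlonger x y)
  rankβ-reflects x y x<r y<r = LongerRank.rank-reflects x y x<r y<r ∘ subst₂ _<_ (rankβ≡rank x) (rankβ≡rank y)

  appended-antitone : ∀ x y → rankβ x < rankβ y → appended y ≤ appended x
  appended-antitone x y ρx<ρy = at-antitone la-dec (s≤s z≤n) (<⇒≤ ρx<ρy)

  longer⇒αlen≥ : ∀ x y → x < r → T (βlonger x y) → αlen y ≤ αlen x
  longer⇒αlen≥ x y x<r xy = +-mono-≤ (Longer.L⇒≥ x y xy) (appended-antitone x y (rankβ-mono x y x<r xy))

  module ByLength = ByDecreasing αlen <ᵇ-isStrictTotal
  module ByLengthRank = Rank ByLength.isStrictTotal r

  before≡byLength : ∀ x y → x < r → y < r → before x y ≡ ByLength.L x y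
  before≡byLength x y x<r y<r with αlen x ≟ αlen y
  ... | yes αx≡αy rewrite αx≡αy | T⇒≡true (≡⇒≡ᵇ (αlen y) (αlen y) refl)
                        | ¬T⇒≡false (<-irrefl refl ∘ <ᵇ⇒< (αlen y) (αlen y)) = refl
  ... | no αx≢αy rewrite ¬T⇒≡false (αx≢αy ∘ ≡ᵇ⇒≡ (αlen x) (αlen y)) | ∨-identityʳ (αlen y <ᵇ αlen x) =
    T-injective (<⇒<ᵇ ∘ ρ<⇒α> ∘ <ᵇ⇒< _ _) (<⇒<ᵇ ∘ α>⇒ρ< ∘ <ᵇ⇒< _ _)
    where
    ρ<⇒α> : rankβ x < rankβ y → αlen y < αlen x
    ρ<⇒α> ρx<ρy = ≤∧≢⇒< (longer⇒αlen≥ x y x<r (rankβ-reflects x y x<r y<r ρx<ρy)) (αx≢αy ∘ sym)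
    α>⇒ρ< : αlen y < αlen x → rankβ x < rankβ y
    α>⇒ρ< αy<αx with <-cmp (rankβ x) (rankβ y)
    ... | tri< ρx<ρy _ _ = ρx<ρy
    ... | tri≈ _ ρx≡ρy _ = ⊥-elim (αx≢αy (cong αlen (rankβ-injective x y x<r y<r ρx≡ρy)))
    ... | tri> _ _ ρy<ρx = ⊥-elim (<⇒≱ αy<αx (longer⇒αlen≥ y x y<r (rankβ-reflects y x y<r x<r ρy<ρx)))

  entryRank≡rank : ∀ i → i < r → entryRank i ≡ ByLengthRank.rank i
  entryRank≡rank i i<r = cong suc (trans (countᵇ-upTo (λ a → before a i) r)
                                         (count-cong _ _ r (λ a a<r → before≡byLength a i a<r i<r)))

  byLength-sorts : ∀ x y → x < r → y < r → T (ByLength.L x y) → appended y ≤ appended x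
  byLength-sorts x y x<r y<r xy with <-cmp (rankβ x) (rankβ y)
  ... | tri< ρx<ρy _ _ = appended-antitone x y ρx<ρy
  ... | tri≈ _ ρx≡ρy _ rewrite rankβ-injective x y x<r y<r ρx≡ρy =
    ⊥-elim (IsStrictTotalᵇ.irrefl ByLength.isStrictTotal y xy)
  ... | tri> _ _ ρy<ρx = +-cancelˡ-≤ (βlen x) (appended y) (appended x) (begin
      βlen x + appended y ≤⟨ +-monoˡ-≤ (appended y) (Longer.L⇒≥ y x yx) ⟩
      αlen y              ≤⟨ ByLength.L⇒≥ x y xy ⟩
      αlen x              ∎)
    where
    open ≤-Reasoning
    yx = rankβ-reflects y x y<r x<r ρy<ρx

  appended≡at-entryRank : ∀ p → p < r → appended p ≡ at la (entryRank p)
  appended≡at-entryRank p p<r = trans (RankSorts.at-rank ByLength.isStrictTotal r la-dec rankβ (λ _ → s≤s z≤n)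
                                         (λ i i<r → subst (_≤ r) (sym (rankβ≡rank i)) (LongerRank.rank≤ i i<r))
                                         rankβ-injective byLength-sorts p p<r)
                                      (cong (at la) (sym (entryRank≡rank p p<r)))

  entryRank-mono : ∀ x y → x < r → y < r → T (ByLength.L x y) → entryRank x < entryRank y
  entryRank-mono x y x<r y<r xy = subst₂ _<_ (sym (entryRank≡rank x x<r)) (sym (entryRank≡rank y y<r))
                                         (ByLengthRank.rank-mono x y x<r xy)

  entryRank-injective : ∀ x y → x < r → y < r → entryRank x ≡ entryRank y → x ≡ y
  entryRank-injective x y x<r y<r ex≡ey = ByLengthRank.rank-injective x y x<r y<r
    (trans (sym (entryRank≡rank x x<r)) (trans ex≡ey (entryRank≡rank y y<r)))

  entryRank-surjective : ∀ m → 1 ≤ m → m ≤ r → ∃ λ p → p < r × entryRank p ≡ m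
  entryRank-surjective m 1≤m m≤r with ByLengthRank.rank-surjective m 1≤m m≤r
  ... | p , p<r , rank≡m = p , p<r , trans (entryRank≡rank p p<r) rank≡m

  βEntry : ℕ → ℕ
  βEntry i = k + (r ∸ i)

  -- 0 for the rows of entryRank > k, which receive no new cells
  newEntry : ℕ → ℕ
  newEntry i = suc k ∸ entryRank i

  module S = LR la β′ filling

  row≡superRow : ∀ i → i < r → rowOf filling i ≡ superRow i
  row≡superRow = rowOf-map-upTo superRow r

  len≡αlen : ∀ i → i < r → S.len i ≡ αlen i
  len≡αlen i i<r = trans (cong length (row≡superRow i i<r)) (length-replicate-++ (βlen i) _ (appended i) _)

  data CellView (i c : ℕ) : Set where
    inβ   : c ≤ βlen i → S.ent i c ≡ βEntry i → CellView i c
    inNew : βlen i < c → S.ent i c ≡ newEntry i → CellView i c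

  cellView : ∀ i c → i < r → 1 ≤ c → c ≤ αlen i → CellView i c
  cellView i c i<r 1≤c c≤α with c ≤? βlen i
  ... | yes c≤β = inβ c≤β (trans (cong (λ row → at row c) (row≡superRow i i<r))
                                  (at-replicate-++ˡ (βlen i) _ (appended i) _ c 1≤c c≤β))
  ... | no c≰β = inNew (≰⇒> c≰β) (trans (cong (λ row → at row c) (row≡superRow i i<r))
                                        (at-replicate-++ʳ (βlen i) _ (appended i) _ c (≰⇒> c≰β) c≤α))

  βCell : ∀ i c → i < r → 1 ≤ c → c ≤ βlen i → S.ent i c ≡ βEntry i
  βCell i c i<r 1≤c c≤β with cellView i c i<r 1≤c (≤-trans c≤β (m≤m+n (βlen i) (appended i)))
  ... | inβ _ e≡ = e≡
  ... | inNew β<c _ = ⊥-elim (<⇒≱ β<c c≤β)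

  k≤r : k ≤ r
  k≤r = subst (k ≤_) (sym (trans (length-++ β) (cong (length β +_) (length-replicate (k ∸ length β)))))
              (m≤n+m∸n k (length β))

  rowOf-letter : ∀ z → 1 ≤ z → z ≤ k → ∃ λ w → w < r × entryRank w ≡ suc k ∸ z
  rowOf-letter z 1≤z z≤k = entryRank-surjective (suc k ∸ z) (m<n⇒0<n∸m (s≤s z≤k))
                                                (≤-trans (∸-monoʳ-≤ (suc k) 1≤z) k≤r)

  0<appended : ∀ i c → βlen i < c → c ≤ αlen i → 0 < appended i
  0<appended i c β<c c≤α = +-cancelˡ-< (βlen i) 0 (appended i)
    (subst (_< αlen i) (sym (+-identityʳ (βlen i))) (<-≤-trans β<c c≤α))

  entryRank≤k : ∀ i → i < r → 0 < appended i → entryRank i ≤ k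
  entryRank≤k i i<r 0<a = 0<at⇒≤length la (entryRank i) (subst (0 <_) (appended≡at-entryRank i i<r) 0<a)

  newEntry≤k : ∀ i → newEntry i ≤ k
  newEntry≤k i = ∸-monoʳ-≤ {1} {entryRank i} (suc k) (s≤s z≤n)

  newEntry<βEntry : ∀ i j → i < r → newEntry j < βEntry i
  newEntry<βEntry i j i<r = ≤-<-trans (newEntry≤k j) (m<m+n k (m<n⇒0<n∸m i<r))

  βEntry-antitone : ∀ i j → i < j → j < r → βEntry j < βEntry i
  βEntry-antitone i j i<j j<r = +-monoʳ-< k (∸-monoʳ-< i<j (<⇒≤ j<r))

  newEntry-antitone : ∀ i j → j < r → 0 < appended j → entryRank i < entryRank j → newEntry j < newEntry i
  newEntry-antitone i j j<r 0<a ei<ej = ∸-monoʳ-< ei<ej (m≤n⇒m≤1+n (entryRank≤k j j<r 0<a))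

  ct1 : ∀ i c → i < r → 1 ≤ c → c < S.len i → S.ent i (suc c) ≤ S.ent i c
  ct1 i c i<r 1≤c c<len = fromCells (cellView i c i<r 1≤c (<⇒≤ c<α)) (cellView i (suc c) i<r (s≤s z≤n) c<α)
    where
    c<α = subst (c <_) (len≡αlen i i<r) c<len
    fromCells : CellView i c → CellView i (suc c) → S.ent i (suc c) ≤ S.ent i c
    fromCells (inβ _ e≡) (inβ _ e′≡) = ≤-reflexive (trans e′≡ (sym e≡))
    fromCells (inβ _ e≡) (inNew _ e′≡) = subst₂ _≤_ (sym e′≡) (sym e≡) (<⇒≤ (newEntry<βEntry i i i<r))
    fromCells (inNew β<c _) (inβ c+1≤β _) = ⊥-elim (<-asym β<c c+1≤β)
    fromCells (inNew _ e≡) (inNew _ e′≡) = ≤-reflexive (trans e′≡ (sym e≡))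

  βlen<⇒αlen< : ∀ i j → j < r → βlen i < βlen j → αlen i < αlen j
  βlen<⇒αlen< i j j<r βi<βj = +-mono-<-≤ βi<βj (appended-antitone j i (rankβ-mono j i j<r (Longer.>⇒L j i βi<βj)))

  ct3-≥ : ∀ i j c → i < j → j < r → 1 ≤ c → c ≤ S.len i → c ≤ S.len j → S.len j ≤ S.len i →
          (S.ent j c < S.ent i c) ⊎ (S.ent i (c ∸ 1) < S.ent j c)
  ct3-≥ i j c i<j j<r 1≤c c≤leni c≤lenj lenj≤leni =
    inj₁ (fromCells (cellView i c i<r 1≤c c≤αi) (cellView j c j<r 1≤c c≤αj))
    where
    i<r = <-trans i<j j<r
    c≤αi = subst (c ≤_) (len≡αlen i i<r) c≤leni
    c≤αj = subst (c ≤_) (len≡αlen j j<r) c≤lenj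
    αj≤αi = subst₂ _≤_ (len≡αlen j j<r) (len≡αlen i i<r) lenj≤leni
    fromCells : CellView i c → CellView j c → S.ent j c < S.ent i c
    fromCells (inβ _ ei≡) (inβ _ ej≡) = subst₂ _<_ (sym ej≡) (sym ei≡) (βEntry-antitone i j i<j j<r)
    fromCells (inβ _ ei≡) (inNew _ ej≡) = subst₂ _<_ (sym ej≡) (sym ei≡) (newEntry<βEntry i j i<r)
    fromCells (inNew βi<c _) (inβ c≤βj _) = ⊥-elim (<⇒≱ (βlen<⇒αlen< i j j<r (<-≤-trans βi<c c≤βj)) αj≤αi)
    fromCells (inNew _ ei≡) (inNew βj<c ej≡) = subst₂ _<_ (sym ej≡) (sym ei≡)
      (newEntry-antitone i j j<r (0<appended j c βj<c c≤αj) (entryRank-mono i j i<r j<r i-first))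
      where
      i-first : T (ByLength.L i j)
      i-first = [ ByLength.>⇒L i j , (λ αj≡αi → ByLength.≡∧t⇒L i j (sym αj≡αi) (<⇒<ᵇ i<j)) ]′
                  (m≤n⇒m<n∨m≡n αj≤αi)

  ct3-< : ∀ i j c → i < j → j < r → 1 ≤ c → c ≤ S.len i → c ≤ S.len j → S.len i < S.len j →
          (S.ent j c < S.ent i c) ⊎ (S.ent i c < S.ent j (suc c))
  ct3-< i j c i<j j<r 1≤c c≤leni c≤lenj leni<lenj = fromCell (cellView i c i<r 1≤c c≤αi)
    where
    i<r = <-trans i<j j<r
    c≤αi = subst (c ≤_) (len≡αlen i i<r) c≤leni
    c≤αj = subst (c ≤_) (len≡αlen j j<r) c≤lenj
    αi<αj = subst₂ _<_ (len≡αlen i i<r) (len≡αlen j j<r) leni<lenj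
    fromCell : CellView i c → (S.ent j c < S.ent i c) ⊎ (S.ent i c < S.ent j (suc c))
    fromCell (inβ _ ei≡) = inj₁ (subst (_ <_) (sym ei≡) (below (cellView j c j<r 1≤c c≤αj)))
      where
      below : CellView j c → S.ent j c < βEntry i
      below (inβ _ ej≡) = subst (_< βEntry i) (sym ej≡) (βEntry-antitone i j i<j j<r)
      below (inNew _ ej≡) = subst (_< βEntry i) (sym ej≡) (newEntry<βEntry i j i<r)
    fromCell (inNew βi<c ei≡) = inj₂ (subst (_< _) (sym ei≡) (above (cellView j (suc c) j<r (s≤s z≤n) c<αj)))
      where
      c<αj = ≤-<-trans c≤αi αi<αj
      above : CellView j (suc c) → newEntry i < S.ent j (suc c)
      above (inβ _ ej≡) = subst (newEntry i <_) (sym ej≡) (newEntry<βEntry j i j<r)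
      above (inNew _ ej≡) = subst (newEntry i <_) (sym ej≡)
        (newEntry-antitone j i i<r (0<appended i c βi<c c≤αi) (entryRank-mono j i j<r i<r (ByLength.>⇒L j i αi<αj)))

  appendedEntries≡ : S.appendedEntries ≡ concat (map (λ i → replicate (appended i) (newEntry i)) (upTo r))
  appendedEntries≡ = cong concat (map-cong-upTo r row≡)
    where
    row≡ : ∀ i → i < r → map (S.ent i) (rangeOC (βlen i) (S.len i)) ≡ replicate (appended i) (newEntry i)
    row≡ i i<r rewrite len≡αlen i i<r | m+n∸m≡n (βlen i) (appended i) =
      trans (sym (map-∘ (upTo (appended i))))
            (map-upTo-const _ (appended i) (newEntry i) (λ t t<a → newCell t t<a))
      where
      newCell : ∀ t → t < appended i → S.ent i (suc (βlen i + t)) ≡ newEntry i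
      newCell t t<a with cellView i (suc (βlen i + t)) i<r (s≤s z≤n) (+-monoʳ-< (βlen i) t<a)
      ... | inβ c≤β _ = ⊥-elim (<⇒≱ (s≤s (m≤m+n (βlen i) t)) c≤β)
      ... | inNew _ e≡ = e≡

  newEntry≡⇒entryRank≡ : ∀ i j → 1 ≤ j → newEntry i ≡ j → entryRank i ≡ suc k ∸ j
  newEntry≡⇒entryRank≡ i j 1≤j e≡j with entryRank i ≤? suc k
  ... | yes e≤ = trans (sym (m∸[m∸n]≡n e≤)) (cong (suc k ∸_) e≡j)
  ... | no e≰ = ⊥-elim (<⇒≱ 1≤j (≤-reflexive (trans (sym e≡j) (m≤n⇒m∸n≡0 (<⇒≤ (≰⇒> e≰))))))

  -- The letter j lies exactly in the row p with entryRank p = k + 1 - j.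
  content : ∀ j → 1 ≤ j → j ≤ k → occ j S.appendedEntries ≡ at la (k ∸ j + 1)
  content j 1≤j j≤k = contentOf (rowOf-letter j 1≤j j≤k)
    where
    contentOf : (∃ λ p → p < r × entryRank p ≡ suc k ∸ j) → occ j S.appendedEntries ≡ at la (k ∸ j + 1)
    contentOf (p , p<r , ep≡) = begin
      occ j S.appendedEntries                                            ≡⟨ cong (occ j) appendedEntries≡ ⟩
      occ j (concat (map (λ i → replicate (appended i) (newEntry i)) (upTo r)))
                                                                         ≡⟨ occ-concat-upTo j _ r ⟩
      sumBelow (λ i → occ j (replicate (appended i) (newEntry i))) r     ≡⟨ sumBelow-single _ r p p<r elsewhere ⟩
      occ j (replicate (appended p) (newEntry p))                        ≡⟨ cong (occ j ∘ replicate (appended p)) Ep≡j ⟩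
      occ j (replicate (appended p) j)                                   ≡⟨ occ-replicate-≡ j (appended p) ⟩
      appended p                                                         ≡⟨ appended≡at-entryRank p p<r ⟩
      at la (entryRank p)                                                ≡⟨ cong (at la) ep≡ ⟩
      at la (suc k ∸ j)                                                  ≡⟨ cong (at la) (1+k∸j≡k∸j+1 j≤k) ⟩
      at la (k ∸ j + 1)                                                  ∎
      where
      open ≡-Reasoning
      1+k∸j≡k∸j+1 : j ≤ k → suc k ∸ j ≡ k ∸ j + 1
      1+k∸j≡k∸j+1 j≤k = trans (cong (_∸ j) (+-comm 1 k)) (+-∸-comm 1 j≤k)
      Ep≡j : newEntry p ≡ j
      Ep≡j = trans (cong (suc k ∸_) ep≡) (m∸[m∸n]≡n (m≤n⇒m≤1+n j≤k))
      elsewhere : ∀ i → i < r → i ≢ p → occ j (replicate (appended i) (newEntry i)) ≡ 0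
      elsewhere i i<r i≢p = occ-replicate-≢ j (appended i) (newEntry i)
        (i≢p ∘ entryRank-injective i p i<r p<r ∘ (λ e≡ → trans e≡ (sym ep≡))
             ∘ newEntry≡⇒entryRank≡ i j 1≤j)

  letters : All (λ x → 1 ≤ x × x ≤ k) S.appendedEntries
  letters = subst (All _) (sym appendedEntries≡) (concat⁺ (map⁺ (applyUpTo⁺₁ id r rowLetters)))
    where
    rowLetters : ∀ {i} → i < r → All (λ x → 1 ≤ x × x ≤ k) (replicate (appended i) (newEntry i))
    rowLetters {i} i<r = replicate⁺-nonempty (appended i)
      (λ 0<a → m<n⇒0<n∸m (s≤s (entryRank≤k i i<r 0<a)) , newEntry≤k i)

  size : S.numAppended ≡ sum la
  size = begin
    S.numAppended                                       ≡⟨ numAppended≡length-appendedEntries la β′ filling ⟩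
    length S.appendedEntries                            ≡⟨ length≡sumBelow-occ k _ letters ⟩
    sumBelow (λ t → occ (suc t) S.appendedEntries) k    ≡⟨ sumBelow-cong k (λ t t<k → content (suc t) (s≤s z≤n) t<k) ⟩
    sumBelow (λ t → at la (k ∸ suc t + 1)) k            ≡⟨ sumBelow-cong k (λ t t<k → cong (at la) (k∸[1+t]+1 t t<k)) ⟩
    sumBelow (λ t → at la (k ∸ t)) k                    ≡⟨ sumBelow-reverse (at la) k ⟩
    sumBelow (get la) k                                 ≡⟨ sumBelow-get la ⟩
    sum la                                              ∎
    where
    open ≡-Reasoning
    k∸[1+t]+1 : ∀ t → t < k → k ∸ suc t + 1 ≡ k ∸ t
    k∸[1+t]+1 t t<k = trans (sym (+-∸-comm 1 t<k)) (cong (_∸ suc t) (+-comm k 1))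

  hasNew : ℕ → ℕ → Bool
  hasNew c i = (βlen i <ᵇ c) ∧ (c <ᵇ suc (S.len i))

  partialColumn : ℕ → ℕ → List ℕ
  partialColumn c m = map (λ i → S.ent i c) (filterᵇ (hasNew c) (upTo m))

  column : ℕ → List ℕ
  column c = partialColumn c r

  columns : ℕ → List ℕ
  columns M = concat (map column (map suc (downFrom M)))

  hasNew⇒ : ∀ c i → i < r → T (hasNew c i) → βlen i < c × c ≤ αlen i
  hasNew⇒ c i i<r h = <ᵇ⇒< _ _ (proj₁ (to T-∧ h))
                    , subst (c ≤_) (len≡αlen i i<r) (≤-pred (<ᵇ⇒< _ _ (proj₂ (to T-∧ h))))

  hasNew⇐ : ∀ c i → i < r → βlen i < c → c ≤ αlen i → T (hasNew c i)
  hasNew⇐ c i i<r β<c c≤α = from T-∧ (<⇒<ᵇ β<c , <⇒<ᵇ (s≤s (subst (c ≤_) (sym (len≡αlen i i<r)) c≤α)))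

  newCell : ∀ c i → i < r → T (hasNew c i) → S.ent i c ≡ newEntry i
  newCell c i i<r h with hasNew⇒ c i i<r h
  ... | β<c , c≤α with cellView i c i<r (≤-trans (s≤s z≤n) β<c) c≤α
  ... | inβ c≤β _ = ⊥-elim (<⇒≱ β<c c≤β)
  ... | inNew _ e≡ = e≡

  newAfter : ℕ → ℕ → ℕ
  newAfter i = cellsAfter (βlen i) (appended i)

  newAfter-step : ∀ i d → i < r → newAfter i d ≡ bit (hasNew (suc d) i) + newAfter i (suc d)
  newAfter-step i d i<r = trans (cellsAfter-step (βlen i) (appended i) d)
    (cong (λ l → bit ((βlen i <ᵇ suc d) ∧ (suc d <ᵇ suc l)) + newAfter i (suc d)) (sym (len≡αlen i i<r)))

  OnlyIn : ℕ → ℕ → Set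
  OnlyIn z w = ∀ c i → i < r → T (hasNew c i) → (S.ent i c ≡ᵇ z) ≡ (i ≡ᵇ w)

  onlyIn : ∀ z w → w < r → 1 ≤ z → z ≤ k → entryRank w ≡ suc k ∸ z → OnlyIn z w
  onlyIn z w w<r 1≤z z≤k ew≡ c i i<r h = trans (cong (_≡ᵇ z) (newCell c i i<r h)) (T-injective
    (λ Ei≡z → ≡⇒≡ᵇ i w (entryRank-injective i w i<r w<r
                         (trans (newEntry≡⇒entryRank≡ i z 1≤z (≡ᵇ⇒≡ _ _ Ei≡z)) (sym ew≡))))
    (λ i≡w → ≡⇒≡ᵇ _ _ (subst (λ x → newEntry x ≡ z) (sym (≡ᵇ⇒≡ i w i≡w))
                         (trans (cong (suc k ∸_) ew≡) (m∸[m∸n]≡n (m≤n⇒m≤1+n z≤k))))))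

  occ-partialColumn : ∀ {z w} c m → OnlyIn z w → m ≤ r →
    occ z (partialColumn c m) ≡ count (λ i → hasNew c i ∧ (i ≡ᵇ w)) m
  occ-partialColumn {z} {w} c m z-only m≤r = begin
    occ z (partialColumn c m)
      ≡⟨ countᵇ-map-filterᵇ _ (λ i → S.ent i c) (hasNew c) (upTo m) ⟩
    countᵇ (λ i → hasNew c i ∧ (S.ent i c ≡ᵇ z)) (upTo m)
      ≡⟨ countᵇ-upTo _ m ⟩
    count (λ i → hasNew c i ∧ (S.ent i c ≡ᵇ z)) m
      ≡⟨ count-cong _ _ m onlyAt-w ⟩
    count (λ i → hasNew c i ∧ (i ≡ᵇ w)) m
      ∎
    where
    open ≡-Reasoning
    onlyAt-w : ∀ i → i < m → hasNew c i ∧ (S.ent i c ≡ᵇ z) ≡ hasNew c i ∧ (i ≡ᵇ w)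
    onlyAt-w i i<m with hasNew c i in h
    ... | true = z-only c i (<-≤-trans i<m m≤r) (subst T (sym h) _)
    ... | false = refl

  occ-column : ∀ {z w} c → OnlyIn z w → w < r → occ z (column c) ≡ bit (hasNew c w)
  occ-column c z-only w<r = trans (occ-partialColumn c r z-only ≤-refl) (count-∧-≡ᵇ-in (hasNew c) _ r w<r)

  take-column : ∀ c n → ∃ λ m → m ≤ r × take n (column c) ≡ partialColumn c m
  take-column c n with take-filterᵇ-upTo (hasNew c) r n
  ... | m , m≤r , eq = m , m≤r , trans (take-map n (filterᵇ (hasNew c) (upTo r))) (cong (map (λ i → S.ent i c)) eq)

  length-filling : length filling ≡ r
  length-filling = trans (length-map superRow (upTo r)) (length-upTo r)

  -- Row q has no more new cells than row p to the right of any column, and if both rows are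
  -- equally long, a column through the new part of q also meets that of p, higher up; so the
  -- count of u never overtakes that of v.
  module PrecedingRows {u v p q : ℕ} (p<r : p < r) (q<r : q < r)
                       (v-only : OnlyIn v p) (u-only : OnlyIn u q) (p-first : T (ByLength.L p q)) where

    appended-q≤p : appended q ≤ appended p
    appended-q≤p = byLength-sorts p q p<r q<r p-first

    -- columns to the right of M are counted by newAfter, those up to M by the prefix
    InvariantAt : ℕ → List ℕ → Set
    InvariantAt M w = occ u w + newAfter q M ≤ occ v w + newAfter p M

    cellsInRow : ℕ → ℕ → ℕ → ℕ
    cellsInRow c w m = count (λ i → hasNew c i ∧ (i ≡ᵇ w)) m

    partial-column : ∀ d m → cellsInRow (suc d) q m + newAfter q (suc d) ≤ cellsInRow (suc d) p m + newAfter p (suc d)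
    partial-column d m with ByLength.view p q p-first
    ... | inj₁ αq<αp = begin
      cellsInRow c q m + newAfter q c  ≤⟨ +-monoˡ-≤ _ (count-∧-≡ᵇ≤ (hasNew c) q m) ⟩
      bit (hasNew c q) + newAfter q c  ≡⟨ newAfter-step q d q<r ⟨
      newAfter q d                     ≤⟨ ⊓-mono-≤ (∸-monoˡ-≤ c αq<αp) appended-q≤p ⟩
      newAfter p c                     ≤⟨ m≤n+m _ _ ⟩
      cellsInRow c p m + newAfter p c  ∎
      where
      open ≤-Reasoning
      c = suc d
    ... | inj₂ (αp≡αq , p<ᵇq) = +-mono-≤ q-then-p
      (⊓-mono-≤ (≤-reflexive (cong (_∸ suc d) (sym αp≡αq))) appended-q≤p)
      where
      c = suc d
      βp≤βq : βlen p ≤ βlen q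
      βp≤βq = +-cancelʳ-≤ (appended q) (βlen p) (βlen q)
                (≤-trans (+-monoʳ-≤ (βlen p) appended-q≤p) (≤-reflexive αp≡αq))
      q-then-p : cellsInRow c q m ≤ cellsInRow c p m
      q-then-p with q <? m
      ... | no q≮m = subst (_≤ _) (sym (count-∧-≡ᵇ-out (hasNew c) q m (≮⇒≥ q≮m))) z≤n
      ... | yes q<m = subst₂ _≤_ (sym (count-∧-≡ᵇ-in (hasNew c) q m q<m))
                                 (sym (count-∧-≡ᵇ-in (hasNew c) p m (<-trans (<ᵇ⇒< p q p<ᵇq) q<m)))
        (bit-mono (λ h → let βq<c , c≤αq = hasNew⇒ c q q<r h in
                         hasNew⇐ c p p<r (≤-<-trans βp≤βq βq<c) (subst (c ≤_) (sym αp≡αq) c≤αq)))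

    within-column : ∀ d n → InvariantAt (suc d) (take n (column (suc d)))
    within-column d n = fromPrefix (take-column (suc d) n)
      where
      fromPrefix : (∃ λ m → m ≤ r × take n (column (suc d)) ≡ partialColumn (suc d) m) →
                   InvariantAt (suc d) (take n (column (suc d)))
      fromPrefix (m , m≤r , take≡) = subst₂ (λ x y → x + newAfter q (suc d) ≤ y + newAfter p (suc d))
        (sym (trans (cong (occ u) take≡) (occ-partialColumn (suc d) m u-only m≤r)))
        (sym (trans (cong (occ v) take≡) (occ-partialColumn (suc d) m v-only m≤r)))
        (partial-column d m)

    prefix-invariant : ∀ M n → InvariantAt M (take n (columns M))
    prefix-invariant zero n rewrite take-[] {A = ℕ} n
                                  | cellsAfter-0 (βlen q) (appended q) | cellsAfter-0 (βlen p) (appended p) =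
      appended-q≤p
    prefix-invariant (suc M) n with take-++-cases n (column (suc M)) (columns M)
    ... | inj₁ take≡ = subst (InvariantAt (suc M)) (sym take≡) (within-column M n)
    ... | inj₂ (n′ , take≡) = subst (InvariantAt (suc M)) (sym take≡) (begin
      occ u (column (suc M) ++ rest) + newAfter q (suc M)
        ≡⟨ cong (_+ newAfter q (suc M)) (countᵇ-++ (_≡ᵇ u) (column (suc M)) rest) ⟩
      occ u (column (suc M)) + occ u rest + newAfter q (suc M)
        ≡⟨ cong (λ x → x + occ u rest + newAfter q (suc M)) (occ-column (suc M) u-only q<r) ⟩
      bit (hasNew (suc M) q) + occ u rest + newAfter q (suc M)
        ≡⟨ xy∙z≈y∙xz (bit (hasNew (suc M) q)) (occ u rest) (newAfter q (suc M)) ⟩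
      occ u rest + (bit (hasNew (suc M) q) + newAfter q (suc M))
        ≡⟨ cong (occ u rest +_) (newAfter-step q M q<r) ⟨
      occ u rest + newAfter q M
        ≤⟨ prefix-invariant M n′ ⟩
      occ v rest + newAfter p M
        ≡⟨ cong (occ v rest +_) (newAfter-step p M p<r) ⟩
      occ v rest + (bit (hasNew (suc M) p) + newAfter p (suc M))
        ≡⟨ xy∙z≈y∙xz (bit (hasNew (suc M) p)) (occ v rest) (newAfter p (suc M)) ⟨
      bit (hasNew (suc M) p) + occ v rest + newAfter p (suc M)
        ≡⟨ cong (λ x → x + occ v rest + newAfter p (suc M)) (occ-column (suc M) v-only p<r) ⟨
      occ v (column (suc M)) + occ v rest + newAfter p (suc M)
        ≡⟨ cong (_+ newAfter p (suc M)) (countᵇ-++ (_≡ᵇ v) (column (suc M)) rest) ⟨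
      occ v (column (suc M) ++ rest) + newAfter p (suc M)
        ∎)
      where
      open ≤-Reasoning
      rest = take n′ (columns M)

    lattice : ∀ n → occ u (take n S.readingWord) ≤ occ v (take n S.readingWord)
    lattice n = begin
      occ u (take n S.readingWord)                        ≤⟨ m≤m+n _ _ ⟩
      occ u (take n S.readingWord) + newAfter q S.maxCol  ≤⟨ prefix-invariant S.maxCol n ⟩
      occ v (take n S.readingWord) + newAfter p S.maxCol  ≡⟨ cong (_ +_) (cellsAfter-end _ _ S.maxCol αp≤maxCol) ⟩
      occ v (take n S.readingWord) + 0                    ≡⟨ +-identityʳ _ ⟩
      occ v (take n S.readingWord)                        ∎
      where
      open ≤-Reasoning
      αp≤maxCol : αlen p ≤ S.maxCol
      αp≤maxCol = subst (_≤ S.maxCol) (len≡αlen p p<r)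
                        (length-rowOf≤maxRow filling p (subst (p <_) (sym length-filling) p<r))

  lr4 : ReverseLattice k S.readingWord
  lr4 n v 2≤v v≤k = latticeFrom (rowOf-letter v 1≤v v≤k) (rowOf-letter (v ∸ 1) 1≤v∸1 v∸1≤k)
    where
    1≤v = ≤-trans (s≤s z≤n) 2≤v
    1≤v∸1 = ∸-monoˡ-≤ 1 2≤v
    v∸1≤k = ≤-trans (m∸n≤m v 1) v≤k
    latticeFrom : (∃ λ p → p < r × entryRank p ≡ suc k ∸ v) →
                  (∃ λ q → q < r × entryRank q ≡ suc k ∸ (v ∸ 1)) →
                  occ (v ∸ 1) (take n S.readingWord) ≤ occ v (take n S.readingWord)
    latticeFrom (p , p<r , ep≡) (q , q<r , eq≡) =
      PrecedingRows.lattice p<r q<r (onlyIn v p p<r 1≤v v≤k ep≡) (onlyIn (v ∸ 1) q q<r 1≤v∸1 v∸1≤k eq≡)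
                            p-first n
      where
      p-first : T (ByLength.L p q)
      p-first = ByLengthRank.rank-reflects p q p<r q<r
        (subst₂ _<_ (trans (sym ep≡) (entryRank≡rank p p<r)) (trans (sym eq≡) (entryRank≡rank q q<r))
                    (∸-monoʳ-< (∸-monoʳ-< {v} {1} {0} z<s 1≤v) (m≤n⇒m≤1+n v≤k)))

proposition4p2 : (la β : List ℕ) → AllPos β → IsPartition la → AllPos la →
    LR.IsLRTableau la (pad (length la) β) (superFilling la β)
proposition4p2 la β _ la-dec _ = record
  { sameRows    = length-filling
  ; βfits       = λ i i<r → subst (βlen i ≤_) (sym (len≡αlen i i<r)) (m≤m+n (βlen i) (appended i))
  ; lr1         = βCell
  ; lr2-size    = size
  ; lr2-content = content
  ; ct1         = ct1
  ; ct3-≥       = ct3-≥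
  ; ct3-<       = ct3-<
  ; lr4         = lr4
  }
  where
  open SuperFilling la β using (appended)
  open SuperFillingProperties la β la-dec
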